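{- In the setting described in the context, assume $N\equiv2\pmod3$ and let $r\in\{0,1,2\}$ with $A\frac CN=\frac{B^2-D}{4N}\equiv r\pmod3$, and suppose $r\in\{1,2\}$. If $D\equiv r\pmod 3$, then $3\mid\theta$ and $3\mid B$.
   Context: Setting: Let $N>1$ be an integer, $N=2^{\lambda(N)}N_1$ with $N_1$ odd. Let $D=c^2\Delta<0$ be a discriminant with fundamental part $\Delta$ and conductor $c$, $K=\mathbb Q(\sqrt D)$, $\mathcal O$ the order of discriminant $D$. Let $[A,B,C]$ be a primitive positive definite integral quadratic form with $B^2-4AC=D$, $\gcd(A,N)=1$ and $N\mid C$ (equivalently $B^2\equiv D\pmod{4N}$). Let $\alpha=\frac{ -B+\sqrt D}{2A}$, so $\mathcal O=\mathbb Z+\mathbb Z A\alpha$. Let $u,v\in\mathbb Z$ be such that $\pi=u+vA\alpha$ has norm $p=u^2-uvB+v^2AC$ a prime number not dividing $6cN$ that splits in $\mathcal O$, and assume $p\mid C$ and $p\mid u$. Set $u'=u-vB$. Let $v_1$, $A_1$ be the odd parts of $v$, $A$ ($v_1=1$ if $v=0$). Define the integer $\theta=(N-1)v\left(u'\frac{C}{Np}+A\left(\frac up(1-u'^2)-u'\right)\right)+3v_1A_1(N_1-1)(u'-1)+\frac{3\lambda(N)(u'^2-1)}{2}.$ -}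

module Defs where

open import Data.Nat.Base as ℕ using (ℕ)
import Data.Nat.Divisibility as ℕD
open import Data.Integer.Base
open import Data.Integer.DivMod using (_/ℕ_)
open import Data.Integer.Divisibility using (_∣_)
open import Data.Product using (∃; _×_; _,_)
open import Data.Sum using (_⊎_)
open import Relation.Nullary using (¬_)
open import Relation.Binary.PropositionalEquality using (_≡_)

Congr : ℕ → ℤ → ℤ → Set
Congr m a b = (+ m) ∣ (a - b)

-- division by a natural number (used only where the division is exact);
-- division by zero returns 0 and never occurs below
_/'_ : ℤ → ℕ → ℤ
x /' ℕ.zero = 0ℤ
x /' ℕ.suc n = x /ℕ ℕ.suc n

SquareFree : ℤ → Set
SquareFree n = ∀ (q : ℕ) → (q ℕ.* q) ℕD.∣ ∣ n ∣ → q ≡ 1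

FundamentalDisc : ℤ → Set
FundamentalDisc Δ =
  (Congr 4 Δ 1ℤ × SquareFree Δ × ¬ (Δ ≡ 1ℤ))
  ⊎ ∃ λ m → Δ ≡ + 4 * m × (Congr 4 m (+ 2) ⊎ Congr 4 m (+ 3)) × SquareFree m

-- an odd prime p not dividing the conductor splits in the order of discriminant D
-- iff the Legendre symbol (D/p) equals 1
SplitsIn : ℤ → ℕ → Set
SplitsIn D p = ¬ ((+ p) ∣ D) × ∃ λ x → Congr p (x * x) D

IsOddPart : ℤ → ℤ → Set
IsOddPart v v1 = (v ≡ 0ℤ × v1 ≡ 1ℤ)
  ⊎ (¬ (+ 2 ∣ v1) × ∃ λ k → v ≡ (+ (2 ℕ.^ k)) * v1)

θ : (N lamN N1 : ℕ) (A B C u v v1 A1 : ℤ) (p : ℕ) → ℤ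
θ N lamN N1 A B C u v v1 A1 p =
  (+ N - 1ℤ) * v * (u' * ((C /' N) /' p) + A * ((u /' p) * (1ℤ - u' * u') - u'))
  + + 3 * v1 * A1 * (+ N1 - 1ℤ) * (u' - 1ℤ)
  + (+ 3 * + lamN * (u' * u' - 1ℤ)) /' 2
  where
  u' : ℤ
  u' = u - v * B

-- Everything is read modulo 3, where N ≡ 2. Since C = N·(C/N), D = B² − 4N·A(C/N) ≡ B² + r,
-- so D ≡ r forces 3 ∣ B, and then u' ≡ u. Dividing the norm equation by p gives
-- (u/p)·u' + v²·A·(C/(Np))·N = 1; in 𝔽₃ this relation, together with A(C/N) ≢ 0, makes the
-- first summand of θ vanish, which is a finite check. The second summand is a multiple of 3,
-- and the third is 3·λ(N)(u'² − 1)/2, where u'² − 1 is even as soon as λ(N) > 0: then C is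
-- even, and the odd prime p = u·u' + v²AC forces u' to be odd.
{-# OPTIONS --safe #-}
module Submission where

open import Defs
open import Data.Nat.Base as ℕ using (ℕ)
import Data.Nat.Divisibility as ℕD
open import Data.Nat.Primality using (Prime; prime?; euclidsLemma; prime⇒irreducible; prime⇒nonZero)
open import Data.Integer.Base
open import Data.Integer.Divisibility using (_∣_)
open import Data.Integer.Divisibility.Signed
  using (divides; ∣-refl; ∣m⇒∣-m; ∣m∣n⇒∣m+n; ∣m∣n⇒∣m-n; ∣m⇒∣m*n; ∣n⇒∣m*n; ∣ᵤ⇒∣; ∣⇒∣ᵤ)
  renaming (_∣_ to _∣ₛ_; _∣?_ to _∣ₛ?_)
open import Data.Integer.GCD using (gcd)
open import Data.Integer.DivMod using (n%ℕd<d; a≡a%ℕn+[a/ℕn]*n)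
open import Data.Integer.Properties
  using (abs-*; +-identityˡ; *-assoc; *-cancelʳ-≡; *-cancelˡ-≡; ∣i∣≡0⇒i≡0)
open import Data.Integer.Tactic.RingSolver using (solve-∀)
open import Data.Fin.Base using (Fin; zero; suc; toℕ; fromℕ<)
open import Data.Fin.Properties using (all?; toℕ-fromℕ<)
open import Data.Product using (_×_; _,_)
open import Data.Sum using (_⊎_; inj₁; inj₂; [_,_]′; reduce)
open import Data.Empty using (⊥-elim)
open import Function using (id; _∘_)
open import Relation.Nullary using (¬_; Dec; ¬?)
open import Relation.Nullary.Decidable using (map′; _→-dec_; toWitness; from-yes; from-no)
open import Relation.Binary.PropositionalEquality
  using (_≡_; _≢_; refl; sym; trans; cong; cong₂; subst; module ≡-Reasoning)

-- Congr unfolds to divisibility of absolute values, which hides both sides from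
-- unification; this record keeps them visible.
infix 4 _≡_mod_ _≡?_mod_
record _≡_mod_ (x y : ℤ) (m : ℕ) : Set where
  constructor congruent
  field m∣x-y : + m ∣ₛ x - y
open _≡_mod_

_≡?_mod_ : ∀ x y m → Dec (x ≡ y mod m)
x ≡? y mod m = map′ congruent m∣x-y (+ m ∣ₛ? x - y)

Congr⇒mod : ∀ {m x y} → Congr m x y → x ≡ y mod m
Congr⇒mod = congruent ∘ ∣ᵤ⇒∣

module _ {m : ℕ} where

  ≡⇒mod : ∀ {x y} → x ≡ y → x ≡ y mod m
  ≡⇒mod {x} refl = congruent (divides 0ℤ (x-x≡0 x))
    where
    x-x≡0 : ∀ x → x - x ≡ 0ℤ
    x-x≡0 = solve-∀

  mod-refl : ∀ {x} → x ≡ x mod m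
  mod-refl = ≡⇒mod refl

  mod-sym : ∀ {x y} → x ≡ y mod m → y ≡ x mod m
  mod-sym {x} {y} (congruent m∣x-y) =
    congruent (subst (+ m ∣ₛ_) (flip x y) (∣m⇒∣-m m∣x-y))
    where
    flip : ∀ x y → - (x - y) ≡ y - x
    flip = solve-∀

  mod-trans : ∀ {x y z} → x ≡ y mod m → y ≡ z mod m → x ≡ z mod m
  mod-trans {x} {y} {z} (congruent m∣x-y) (congruent m∣y-z) =
    congruent (subst (+ m ∣ₛ_) (telescope x y z) (∣m∣n⇒∣m+n m∣x-y m∣y-z))
    where
    telescope : ∀ x y z → (x - y) + (y - z) ≡ x - z
    telescope = solve-∀

  ∣-resp-mod : ∀ {x y} → x ≡ y mod m → + m ∣ₛ x → + m ∣ₛ y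
  ∣-resp-mod {x} {y} (congruent m∣x-y) m∣x =
    subst (+ m ∣ₛ_) (cancel x y) (∣m∣n⇒∣m-n m∣x m∣x-y)
    where
    cancel : ∀ x y → x - (x - y) ≡ y
    cancel = solve-∀

  ∣⇒≡0-mod : ∀ {x} → + m ∣ₛ x → x ≡ 0ℤ mod m
  ∣⇒≡0-mod {x} = congruent ∘ subst (+ m ∣ₛ_) (sym (x-0≡x x))
    where
    x-0≡x : ∀ x → x - 0ℤ ≡ x
    x-0≡x = solve-∀

  infixl 6 _⟨+⟩_ _⟨-⟩_
  infixl 7 _⟨*⟩_

  _⟨+⟩_ : ∀ {a b c d} → a ≡ b mod m → c ≡ d mod m → a + c ≡ b + d mod m
  _⟨+⟩_ {a} {b} {c} {d} (congruent m∣a-b) (congruent m∣c-d) =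
    congruent (subst (+ m ∣ₛ_) (regroup a b c d) (∣m∣n⇒∣m+n m∣a-b m∣c-d))
    where
    regroup : ∀ a b c d → (a - b) + (c - d) ≡ (a + c) - (b + d)
    regroup = solve-∀

  _⟨-⟩_ : ∀ {a b c d} → a ≡ b mod m → c ≡ d mod m → a - c ≡ b - d mod m
  _⟨-⟩_ {a} {b} {c} {d} (congruent m∣a-b) (congruent m∣c-d) =
    congruent (subst (+ m ∣ₛ_) (regroup a b c d) (∣m∣n⇒∣m-n m∣a-b m∣c-d))
    where
    regroup : ∀ a b c d → (a - b) - (c - d) ≡ (a - c) - (b - d)
    regroup = solve-∀

  _⟨*⟩_ : ∀ {a b c d} → a ≡ b mod m → c ≡ d mod m → a * c ≡ b * d mod m
  _⟨*⟩_ {a} {b} {c} {d} (congruent m∣a-b) (congruent m∣c-d) =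
    congruent (subst (+ m ∣ₛ_) (regroup a b c d)
      (∣m∣n⇒∣m+n (∣m⇒∣m*n c m∣a-b) (∣n⇒∣m*n b m∣c-d)))
    where
    regroup : ∀ a b c d → (a - b) * c + b * (c - d) ≡ a * c - b * d
    regroup = solve-∀

ι : ∀ {m} → Fin m → ℤ
ι = +_ ∘ toℕ

residue : ∀ m .{{_ : ℕ.NonZero m}} → ℤ → Fin m
residue m x = fromℕ< (n%ℕd<d x m)

residue≈ : ∀ m .{{_ : ℕ.NonZero m}} x → ι (residue m x) ≡ x mod m
residue≈ m x rewrite toℕ-fromℕ< (n%ℕd<d x m) =
  mod-sym (congruent (divides (x /ℕ m) (begin
    x - ρ                      ≡⟨ cong (_- ρ) (a≡a%ℕn+[a/ℕn]*n x m) ⟩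
    (ρ + (x /ℕ m) * + m) - ρ   ≡⟨ cancel ρ _ ⟩
    (x /ℕ m) * + m             ∎)))
  where
  open ≡-Reasoning
  ρ : ℤ
  ρ = + (x %ℕ m)
  cancel : ∀ a b → (a + b) - a ≡ b
  cancel = solve-∀

%ℕ≡0 : ∀ x d .{{_ : ℕ.NonZero d}} → d ℕD.∣ ∣ x ∣ → x %ℕ d ≡ 0
%ℕ≡0 (+ n)    d d∣n = ℕD.n∣m⇒m%n≡0 n d d∣n
%ℕ≡0 -[1+ n ] d d∣n rewrite ℕD.n∣m⇒m%n≡0 (ℕ.suc n) d d∣n = refl

/'-exact : ∀ d x → + d ∣ x → x ≡ (x /' d) * + d
/'-exact ℕ.zero      x 0∣x = ∣i∣≡0⇒i≡0 (ℕD.0∣⇒≡0 0∣x)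
/'-exact d@(ℕ.suc _) x d∣x = trans (a≡a%ℕn+[a/ℕn]*n x d)
  (trans (cong (λ r → + r + (x /ℕ d) * + d) (%ℕ≡0 x d d∣x)) (+-identityˡ _))

∣[m*x]/'d : ∀ m d x → + d ∣ₛ x → + m ∣ₛ (+ m * x) /' d
∣[m*x]/'d m ℕ.zero      x _   = divides 0ℤ refl
∣[m*x]/'d m d@(ℕ.suc _) x d∣x = subst (+ m ∣ₛ_) (sym quotient) (∣m⇒∣m*n (x /' d) ∣-refl)
  where
  open ≡-Reasoning
  quotient : (+ m * x) /' d ≡ + m * (x /' d)
  quotient = *-cancelʳ-≡ _ _ (+ d) (begin
    ((+ m * x) /' d) * + d  ≡⟨ /'-exact d (+ m * x) (∣⇒∣ᵤ (∣n⇒∣m*n (+ m) d∣x)) ⟨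
    + m * x                 ≡⟨ cong (+ m *_) (/'-exact d x (∣⇒∣ᵤ d∣x)) ⟩
    + m * ((x /' d) * + d)  ≡⟨ *-assoc (+ m) (x /' d) (+ d) ⟨
    + m * (x /' d) * + d    ∎)

prime∣x⇒prime∣x/'d : ∀ {p} d x → Prime p → ¬ p ℕD.∣ d → + d ∣ x → + p ∣ x → + p ∣ x /' d
prime∣x⇒prime∣x/'d {p} d x prime-p p∤d d∣x p∣x = [ id , ⊥-elim ∘ p∤d ]′
  (euclidsLemma ∣ x /' d ∣ d prime-p
    (subst (p ℕD.∣_) (trans (cong ∣_∣ (/'-exact d x d∣x)) (abs-* (x /' d) (+ d))) p∣x))

nontrivial∣n⇒∤prime : ∀ {d n p} → Prime p → ¬ p ℕD.∣ n → d ℕD.∣ n → d ≢ 1 → ¬ d ℕD.∣ p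
nontrivial∣n⇒∤prime prime-p p∤n d∣n d≢1 d∣p with prime⇒irreducible prime-p d∣p
... | inj₁ d≡1  = d≢1 d≡1
... | inj₂ refl = p∤n d∣n

3∣B-of-discriminant : ∀ A B C C' D n r → B * B - + 4 * A * C ≡ D → C ≡ C' * n →
  n ≡ + 2 mod 3 → A * C' ≡ r mod 3 → D ≡ r mod 3 → + 3 ∣ₛ B
3∣B-of-discriminant A B C C' D n r disc C≡C'n n≈2 AC'≈r D≈r =
  ∣ᵤ⇒∣ (reduce (euclidsLemma ∣ B ∣ ∣ B ∣ (from-yes (prime? 3))
    (subst (3 ℕD.∣_) (abs-* B B) (∣⇒∣ᵤ 3∣B²))))
  where
  open ≡-Reasoning
  complete : ∀ x y → x ≡ (x - y) + y
  complete = solve-∀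
  regroup : ∀ a b c d → a + + 4 * b * (c * d) ≡ a + + 4 * d * (b * c)
  regroup = solve-∀
  nine : ∀ r → r + + 4 * + 2 * r ≡ + 3 * (+ 3 * r)
  nine = solve-∀
  B²≡ : B * B ≡ D + + 4 * n * (A * C')
  B²≡ = begin
    B * B                                ≡⟨ complete (B * B) (+ 4 * A * C) ⟩
    (B * B - + 4 * A * C) + + 4 * A * C  ≡⟨ cong₂ (λ x y → x + + 4 * A * y) disc C≡C'n ⟩
    D + + 4 * A * (C' * n)               ≡⟨ regroup D A C' n ⟩
    D + + 4 * n * (A * C')               ∎
  B²≈9r : + 3 * (+ 3 * r) ≡ B * B mod 3
  B²≈9r = mod-sym (mod-trans (≡⇒mod B²≡)
    (mod-trans (D≈r ⟨+⟩ mod-refl {x = + 4} ⟨*⟩ n≈2 ⟨*⟩ AC'≈r) (≡⇒mod (nine r))))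
  3∣B² : + 3 ∣ₛ B * B
  3∣B² = ∣-resp-mod B²≈9r (∣m⇒∣m*n (+ 3 * r) ∣-refl)

-- θ's first summand is (N - 1) * θ-principal A (C/(Np)) (u/p) u' v.
θ-principal : (a c w u' v : ℤ) → ℤ
θ-principal a c w u' v = v * (u' * c + a * (w * (1ℤ - u' * u') - u'))

-- 3∣θ-principal read in 𝔽₃, where u' ≡ wπ (as 3 ∣ B) and N ≡ 2.
PrincipalTermVanishes : (a c π v w : ℤ) → Set
PrincipalTermVanishes a c π v w = ¬ + 3 ∣ₛ a * (c * π) →
  w * (w * π) + v * v * a * c * + 2 ≡ 1ℤ mod 3 → + 3 ∣ₛ θ-principal a c w (w * π) v

principalTermVanishes? : ∀ a c π v w → Dec (PrincipalTermVanishes a c π v w)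
principalTermVanishes? a c π v w = ¬? (+ 3 ∣ₛ? a * (c * π))
  →-dec w * (w * π) + v * v * a * c * + 2 ≡? 1ℤ mod 3
  →-dec + 3 ∣ₛ? θ-principal a c w (w * π) v

principalTermVanishes-residues : ∀ (a c π v w : Fin 3) →
  PrincipalTermVanishes (ι a) (ι c) (ι π) (ι v) (ι w)
principalTermVanishes-residues = toWitness
  {a? = all? λ a → all? λ c → all? λ π → all? λ v → all? λ w →
          principalTermVanishes? (ι a) (ι c) (ι π) (ι v) (ι w)} _

3∣θ-principal : ∀ a c π v w u' n → u' ≡ w * π mod 3 → n ≡ + 2 mod 3 →
  ¬ + 3 ∣ₛ a * (c * π) → w * u' + v * v * a * c * n ≡ 1ℤ → + 3 ∣ₛ θ-principal a c w u' v
3∣θ-principal a c π v w u' n u'≈wπ n≈2 3∤acπ norm≡1 =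
  ∣-resp-mod (v≈ ⟨*⟩ (u≈ ⟨*⟩ c≈ ⟨+⟩ a≈ ⟨*⟩ (w≈ ⟨*⟩ (mod-refl {x = 1ℤ} ⟨-⟩ u≈ ⟨*⟩ u≈) ⟨-⟩ u≈)))
    (principalTermVanishes-residues
      (residue 3 a) (residue 3 c) (residue 3 π) (residue 3 v) (residue 3 w)
      (3∤acπ ∘ ∣-resp-mod (a≈ ⟨*⟩ (c≈ ⟨*⟩ π≈)))
      (mod-trans (w≈ ⟨*⟩ u≈ ⟨+⟩ v≈ ⟨*⟩ v≈ ⟨*⟩ a≈ ⟨*⟩ c≈ ⟨*⟩ mod-sym n≈2) (≡⇒mod norm≡1)))
  where
  a≈ : ι (residue 3 a) ≡ a mod 3
  a≈ = residue≈ 3 a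
  c≈ : ι (residue 3 c) ≡ c mod 3
  c≈ = residue≈ 3 c
  π≈ : ι (residue 3 π) ≡ π mod 3
  π≈ = residue≈ 3 π
  v≈ : ι (residue 3 v) ≡ v mod 3
  v≈ = residue≈ 3 v
  w≈ : ι (residue 3 w) ≡ w mod 3
  w≈ = residue≈ 3 w
  u≈ : ι (residue 3 w) * ι (residue 3 π) ≡ u' mod 3
  u≈ = mod-trans (w≈ ⟨*⟩ π≈) (mod-sym u'≈wπ)

norm/p≡1 : ∀ p .{{_ : ℕ.NonZero p}} u v A B C w c n → u ≡ w * + p → C ≡ c * + p * n →
  + p ≡ u * u - u * v * B + v * v * A * C → w * (u - v * B) + v * v * A * c * n ≡ 1ℤ
norm/p≡1 p _ v A B _ w c n refl refl norm = *-cancelˡ-≡ (+ p) _ 1ℤ (begin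
  + p * (w * (w * + p - v * B) + v * v * A * c * n)                  ≡⟨ expand (+ p) w v A B c n ⟩
  w * + p * (w * + p) - w * + p * v * B + v * v * A * (c * + p * n)  ≡⟨ norm ⟨
  + p                                                                ≡⟨ p≡p*1 (+ p) ⟩
  + p * 1ℤ                                                           ∎)
  where
  open ≡-Reasoning
  expand : ∀ p w v A B c n → p * (w * (w * p - v * B) + v * v * A * c * n)
    ≡ w * p * (w * p) - w * p * v * B + v * v * A * (c * p * n)
  expand = solve-∀
  p≡p*1 : ∀ p → p ≡ p * 1ℤ
  p≡p*1 = solve-∀

norm⇒3∣θ-principal : ∀ p u v A B C w c n → ℕ.NonZero p → u ≡ w * + p → C ≡ c * + p * n →
  + p ≡ u * u - u * v * B + v * v * A * C → + 3 ∣ₛ B → n ≡ + 2 mod 3 → ¬ + 3 ∣ₛ A * (c * + p) →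
  + 3 ∣ₛ θ-principal A c w (u - v * B) v
norm⇒3∣θ-principal p u v A B C w c n p≢0 u≡wp C≡cpn norm 3∣B n≈2 3∤Acp =
  3∣θ-principal A c (+ p) v w (u - v * B) n u'≈wp n≈2 3∤Acp
    (norm/p≡1 p {{p≢0}} u v A B C w c n u≡wp C≡cpn norm)
  where
  u-v*0≡u : ∀ u v → u - v * 0ℤ ≡ u
  u-v*0≡u = solve-∀
  u'≈wp : u - v * B ≡ w * + p mod 3
  u'≈wp = mod-trans (mod-refl {x = u} ⟨-⟩ mod-refl {x = v} ⟨*⟩ ∣⇒≡0-mod 3∣B)
    (≡⇒mod (trans (u-v*0≡u u v) u≡wp))

odd-square-residues : ∀ (x : Fin 2) → ¬ + 2 ∣ₛ ι x → + 2 ∣ₛ ι x * ι x - 1ℤ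
odd-square-residues zero       2∤0 = ⊥-elim (2∤0 (divides 0ℤ refl))
odd-square-residues (suc zero) _   = divides 0ℤ refl

odd⇒2∣x*x-1 : ∀ x → ¬ + 2 ∣ₛ x → + 2 ∣ₛ x * x - 1ℤ
odd⇒2∣x*x-1 x 2∤x =
  ∣-resp-mod (x≈ ⟨*⟩ x≈ ⟨-⟩ mod-refl {x = 1ℤ})
    (odd-square-residues (residue 2 x) (2∤x ∘ ∣-resp-mod x≈))
  where
  x≈ : ι (residue 2 x) ≡ x mod 2
  x≈ = residue≈ 2 x

odd-norm⇒odd : ∀ p u v A B C → + p ≡ u * u - u * v * B + v * v * A * C →
  + 2 ∣ₛ C → ¬ + 2 ∣ₛ + p → ¬ + 2 ∣ₛ u - v * B
odd-norm⇒odd p u v A B C norm 2∣C 2∤p 2∣u-vB =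
  2∤p (subst (+ 2 ∣ₛ_) (sym (trans norm (factor u v A B C)))
    (∣m∣n⇒∣m+n (∣n⇒∣m*n u 2∣u-vB) (∣n⇒∣m*n (v * v * A) 2∣C)))
  where
  factor : ∀ u v A B C → u * u - u * v * B + v * v * A * C ≡ u * (u - v * B) + v * v * A * C
  factor = solve-∀

2∣λ*[x*x-1] : ∀ N lamN N1 x → N ≡ 2 ℕ.^ lamN ℕ.* N1 → (2 ℕD.∣ N → ¬ + 2 ∣ₛ x) →
  + 2 ∣ₛ + lamN * (x * x - 1ℤ)
2∣λ*[x*x-1] _ ℕ.zero      _  _ _    _        = divides 0ℤ refl
2∣λ*[x*x-1] _ (ℕ.suc l)   N1 x refl 2∣N⇒2∤x =
  ∣n⇒∣m*n (+ ℕ.suc l) (odd⇒2∣x*x-1 x (2∣N⇒2∤x (ℕD.∣-trans (ℕD.m∣m*n (2 ℕ.^ l)) (ℕD.m∣m*n N1))))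

3∣3λ[u'²-1]/2 : ∀ N lamN N1 p u v A B C → N ≡ 2 ℕ.^ lamN ℕ.* N1 → + N ∣ C → ¬ 2 ℕD.∣ p →
  + p ≡ u * u - u * v * B + v * v * A * C →
  + 3 ∣ₛ (+ 3 * + lamN * ((u - v * B) * (u - v * B) - 1ℤ)) /' 2
3∣3λ[u'²-1]/2 N lamN N1 p u v A B C N≡2^λN1 N∣C 2∤p norm =
  subst (λ z → + 3 ∣ₛ z /' 2) (sym (*-assoc (+ 3) (+ lamN) _))
    (∣[m*x]/'d 3 2 _ (2∣λ*[x*x-1] N lamN N1 (u - v * B) N≡2^λN1 2∣N⇒2∤u'))
  where
  2∣N⇒2∤u' : 2 ℕD.∣ N → ¬ + 2 ∣ₛ u - v * B
  2∣N⇒2∤u' 2∣N = odd-norm⇒odd p u v A B C norm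
    (subst (+ 2 ∣ₛ_) (sym (/'-exact N C N∣C)) (∣n⇒∣m*n (C /' N) (∣ᵤ⇒∣ 2∣N))) (2∤p ∘ ∣⇒∣ᵤ)

3∤1or2 : ∀ {r} → r ≡ + 1 ⊎ r ≡ + 2 → ¬ + 3 ∣ₛ r
3∤1or2 (inj₁ refl) = from-no (+ 3 ∣ₛ? + 1)
3∤1or2 (inj₂ refl) = from-no (+ 3 ∣ₛ? + 2)

mainTheorem5 : (N lamN N1 : ℕ) → 1 ℕ.< N → N ≡ 2 ℕ.^ lamN ℕ.* N1 → ¬ (2 ℕD.∣ N1) →
    (D Δ : ℤ) (c : ℕ) → 1 ℕ.≤ c → FundamentalDisc Δ → D ≡ + (c ℕ.* c) * Δ → D < 0ℤ →
    (A B C : ℤ) → gcd (gcd A B) C ≡ 1ℤ → 0ℤ < A → B * B - + 4 * A * C ≡ D →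
    gcd A (+ N) ≡ 1ℤ → + N ∣ C →
    (u v : ℤ) (p : ℕ) → Prime p → + p ≡ u * u - u * v * B + v * v * A * C →
    ¬ (p ℕD.∣ 6 ℕ.* c ℕ.* N) → SplitsIn D p → + p ∣ C → + p ∣ u →
    (v1 A1 : ℤ) → IsOddPart v v1 → IsOddPart A A1 →
    Congr 3 (+ N) (+ 2) →
    (r : ℤ) → (r ≡ + 1 ⊎ r ≡ + 2) → Congr 3 (A * (C /' N)) r →
    Congr 3 D r →
    (+ 3 ∣ θ N lamN N1 A B C u v v1 A1 p) × (+ 3 ∣ B)
mainTheorem5 N lamN N1 _ N≡2^λN1 _ D _ c _ _ _ _ A B C _ _ disc _ N∣C u v p prime-p norm p∤6cN _
  p∣C p∣u v1 A1 _ _ N≡2 r r≡1or2 AC'≡r D≡r =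
  ∣⇒∣ᵤ (∣m∣n⇒∣m+n (∣m∣n⇒∣m+n 3∣first 3∣second) 3∣third) , ∣⇒∣ᵤ 3∣B
  where
  C' C'' u' : ℤ
  C' = C /' N
  C'' = C' /' p
  u' = u - v * B
  p∤N : ¬ p ℕD.∣ N
  p∤N p∣N = p∤6cN (ℕD.∣-trans p∣N (ℕD.n∣m*n (6 ℕ.* c)))
  2∤p : ¬ 2 ℕD.∣ p
  2∤p = nontrivial∣n⇒∤prime prime-p p∤6cN
    (ℕD.∣-trans (ℕD.divides 3 refl) (ℕD.∣-trans (ℕD.m∣m*n c) (ℕD.m∣m*n N))) (λ ())
  C≡C'N : C ≡ C' * + N
  C≡C'N = /'-exact N C N∣C
  C'≡C''p : C' ≡ C'' * + p
  C'≡C''p = /'-exact p C' (prime∣x⇒prime∣x/'d N C prime-p p∤N N∣C p∣C)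
  3∣B : + 3 ∣ₛ B
  3∣B = 3∣B-of-discriminant A B C C' D (+ N) r disc C≡C'N
    (Congr⇒mod N≡2) (Congr⇒mod AC'≡r) (Congr⇒mod D≡r)
  3∤AC''p : ¬ + 3 ∣ₛ A * (C'' * + p)
  3∤AC''p = 3∤1or2 r≡1or2 ∘ ∣-resp-mod (Congr⇒mod AC'≡r)
    ∘ subst (+ 3 ∣ₛ_) (cong (A *_) (sym C'≡C''p))
  3∣first : + 3 ∣ₛ (+ N - 1ℤ) * v * (u' * C'' + A * ((u /' p) * (1ℤ - u' * u') - u'))
  3∣first = subst (+ 3 ∣ₛ_) (sym (*-assoc (+ N - 1ℤ) v _)) (∣n⇒∣m*n (+ N - 1ℤ)
    (norm⇒3∣θ-principal p u v A B C (u /' p) C'' (+ N) (prime⇒nonZero prime-p)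
      (/'-exact p u p∣u) (trans C≡C'N (cong (_* + N) C'≡C''p)) norm 3∣B (Congr⇒mod N≡2) 3∤AC''p))
  3∣second : + 3 ∣ₛ + 3 * v1 * A1 * (+ N1 - 1ℤ) * (u' - 1ℤ)
  3∣second = ∣m⇒∣m*n (u' - 1ℤ) (∣m⇒∣m*n (+ N1 - 1ℤ) (∣m⇒∣m*n A1 (∣m⇒∣m*n v1 (∣-refl {+ 3}))))
  3∣third : + 3 ∣ₛ (+ 3 * + lamN * (u' * u' - 1ℤ)) /' 2
  3∣third = 3∣3λ[u'²-1]/2 N lamN N1 p u v A B C N≡2^λN1 N∣C 2∤p norm
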